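{- Let $n,m\ge1$, $R\le D_4$, and $T$ a set of tile designs for $R$. For $g\in R$ let $\mathrm{Fix}_g(n,m)$ be the number of tilings of the $n\times m$ grid by $T$ fixed by $g$. Then $\mathrm{Fix}_{\mathrm{id}}(n,m)=t_{\mathrm{id}}^{nm}$; $\mathrm{Fix}_{r^2}(n,m)=t_{\mathrm{id}}^{nm/2}$ if $nm$ is even and $t_{\mathrm{id}}^{(nm-1)/2}t_{r^2}$ if $nm$ is odd; $\mathrm{Fix}_{f}(n,m)=t_{\mathrm{id}}^{nm/2}$ if $n$ is even and $t_{\mathrm{id}}^{m(n-1)/2}t_f^m$ if $n$ is odd; $\mathrm{Fix}_{r^2f}(n,m)=t_{\mathrm{id}}^{nm/2}$ if $m$ is even and $t_{\mathrm{id}}^{n(m-1)/2}t_{r^2f}^n$ if $m$ is odd (each formula for $g$ in $R$). Moreover the number of distinct tilings of the $n\times m$ grid up to the action of $R$ is $\frac{1}{|R|}\sum_{g\in R}\mathrm{Fix}_g(n,m)$.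
   Context: The $n\times m$ grid is the set of cells $\mathbb{Z}/n\mathbb{Z}\times\mathbb{Z}/m\mathbb{Z}$. $D_4=\langle r^2,f\mid (r^2)^2=f^2=\mathrm{id}\rangle$ (the dihedral group of the rectangle, inside $D_8=\langle r,f\mid r^4=f^2=(rf)^2=\mathrm{id}\rangle$) acts on cells on the right by $(x,y)\cdot f=(n-1-x,y)$, $(x,y)\cdot r^2=(n-1-x,m-1-y)$, $(x,y)\cdot r^2f=(x,m-1-y)$. A set of tile designs for $R$ is a finite set $T$ with a right action of $R$; $t_g=|\{d\in T:d\cdot g=d\}|$. A tiling is a map $\tau$ from cells to $T$; $g$ acts on tilings by $(\tau\cdot g)(c\cdot g)=\tau(c)\cdot g$, and $\tau$ is fixed by $g$ if $\tau(c\cdot g)=\tau(c)\cdot g$ for all cells $c$. Distinct tilings up to $R$ means orbits of tilings under this action. -}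

module Defs where

open import Data.Nat using (ℕ; zero; suc; _+_; _*_)
open import Data.Bool using (Bool; true; false)
open import Data.Fin using (Fin; opposite)
open import Data.Fin.Properties using (all?; _≟_)
open import Data.Product using (Σ; _×_; _,_; ∃)
open import Data.List using (List; []; _∷_; length; filter; allFin; map; concatMap)
open import Data.Nat.ListAction using (sum)
open import Data.Vec using (Vec; lookup; tabulate)
import Data.Vec as Vec
open import Relation.Binary.PropositionalEquality using (_≡_)
open import Relation.Nullary using (Dec)
open import Relation.Unary using (Decidable)

-- The group D4 = {id, r², f, r²f} (dihedral group of the rectangle)

data D4 : Set where
  e r2 f r2f : D4

allD4 : List D4
allD4 = e ∷ r2 ∷ f ∷ r2f ∷ []

_·_ : D4 → D4 → D4
e   · h   = h
g   · e   = g
r2  · r2  = e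
r2  · f   = r2f
r2  · r2f = f
f   · r2  = r2f
f   · f   = e
f   · r2f = r2
r2f · r2  = f
r2f · f   = r2
r2f · r2f = e

inv : D4 → D4
inv g = g

record Subgroup : Set where
  field
    mem    : D4 → Bool
    has-e  : mem e ≡ true
    closed : ∀ g h → mem g ≡ true → mem h ≡ true → mem (g · h) ≡ true
    -- (closure under inverses is automatic: every element is its own inverse,
    --  but we state it anyway for fidelity)
    has-inv : ∀ g → mem g ≡ true → mem (inv g) ≡ true

open Subgroup public

elemsOf : Subgroup → List D4
elemsOf R = filter (λ g → Data.Bool._≟_ (mem R g) true) allD4

order : Subgroup → ℕ
order R = length (elemsOf R)

Cell : ℕ → ℕ → Set
Cell n m = Fin n × Fin m

cellAct : ∀ {n m} → Cell n m → D4 → Cell n m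
cellAct (x , y) e   = (x , y)
cellAct (x , y) r2  = (opposite x , opposite y)
cellAct (x , y) f   = (opposite x , y)
cellAct (x , y) r2f = (x , opposite y)

-- The action map is given on all of D4, but the action laws are only
-- required for elements of R (values outside R are irrelevant).

record TileDesigns (R : Subgroup) : Set where
  field
    k     : ℕ
    act   : Fin k → D4 → Fin k
    act-e : ∀ d → act d e ≡ d
    act-· : ∀ d g h → mem R g ≡ true → mem R h ≡ true →
            act (act d g) h ≡ act d (g · h)

open TileDesigns public

tfix : ∀ {R} → TileDesigns R → D4 → ℕ
tfix T g = length (filter (λ d → act T d g ≟ d) (allFin (k T)))

Tiling : ℕ → ℕ → ℕ → Set
Tiling n m k = Vec (Vec (Fin k) m) n

at : ∀ {n m k} → Tiling n m k → Cell n m → Fin k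
at τ (x , y) = lookup (lookup τ x) y

allVecs : ∀ {A : Set} → List A → (n : ℕ) → List (Vec A n)
allVecs xs zero    = Vec.[] ∷ []
allVecs xs (suc n) = concatMap (λ x → map (x Vec.∷_) (allVecs xs n)) xs

allTilings : ∀ n m k → List (Tiling n m k)
allTilings n m k = allVecs (allVecs (allFin k) m) n

FixedBy : ∀ {R} (T : TileDesigns R) {n m} → D4 → Tiling n m (k T) → Set
FixedBy T g τ = ∀ x y → at τ (cellAct (x , y) g) ≡ act T (at τ (x , y)) g

fixedBy? : ∀ {R} (T : TileDesigns R) {n m} (g : D4) → Decidable (FixedBy T {n} {m} g)
fixedBy? T g τ = all? (λ x → all? (λ y → at τ (cellAct (x , y) g) ≟ act T (at τ (x , y)) g))

Fix : ∀ {R} (T : TileDesigns R) (n m : ℕ) → D4 → ℕ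
Fix T n m g = length (filter (fixedBy? T g) (allTilings n m (k T)))

-- the action of g on tilings: (τ·g)(c·g) = τ(c)·g, i.e. (τ·g)(c) = τ(c·g⁻¹)·g
tilingAct : ∀ {R} (T : TileDesigns R) {n m} → Tiling n m (k T) → D4 → Tiling n m (k T)
tilingAct T τ g = tabulate (λ x → tabulate (λ y → act T (at τ (cellAct (x , y) (inv g))) g))

SameOrbit : ∀ {R} (T : TileDesigns R) {n m} → Tiling n m (k T) → Tiling n m (k T) → Set
SameOrbit {R} T τ σ = Σ D4 λ g → mem R g ≡ true × σ ≡ tilingAct T τ g

-- "the number of distinct tilings up to R is N": there is a transversal
-- of the orbits of size N (each tiling is in the orbit of exactly one
-- representative).
NumOrbits : ∀ {R} (T : TileDesigns R) (n m N : ℕ) → Set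
NumOrbits T n m N =
  Σ (Fin N → Tiling n m (k T)) λ rep →
    (∀ τ → ∃ λ i → SameOrbit T (rep i) τ) ×
    (∀ i j → SameOrbit T (rep i) (rep j) → i ≡ j)

sumFix : ∀ {R} (T : TileDesigns R) (n m : ℕ) → ℕ
sumFix {R} T n m = sum (map (Fix T n m) (elemsOf R))

module Submission where

-- Being fixed by a reflection is a
-- twisted palindrome condition: τ is fixed by f iff its rows read backwards are its rows with f
-- applied to every design, by r²f iff every row read backwards is that row acted on by r²f, and
-- by r² iff its rows read backwards are its rows reversed and acted on by r². For an involution σ
-- of a K-element set with t fixed points, the vectors v with reverse v = map σ v number K^q in
-- length 2q and K^q·t in length 2q+1 (the first half is free, a middle entry must be fixed by σ),
-- which gives the formulas for Fix.
--
-- For the orbit count, represent each orbit by its first tiling in a fixed enumeration. If the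
-- representative of τ is τ·g₀, then g ∈ R fixes τ iff τ·(g g₀) is a representative, so
-- reindexing g ↦ g g₀ turns Σ_g Fix_g(n,m) into Σ_g #{τ : τ·g is a representative}, and each
-- inner count is the number of orbits because τ ↦ τ·g is a bijection.

open import Algebra.Definitions using (Involutive)
open import Algebra.Properties.CommutativeSemigroup using (interchange)
open import Data.Bool using (true; if_then_else_)
import Data.Bool as Bool
open import Data.Empty using (⊥-elim)
open import Data.Fin using (Fin; zero; suc; opposite; fromℕ; inject₁)
import Data.Fin.Properties as Fin
open import Data.Fin.Relation.Unary.Top using (view; ‵fromℕ; ‵inject₁)
open import Data.List using (List; []; _∷_; length; filter; map; concatMap; _++_; allFin; find)
import Data.List as List
open import Data.List.Membership.Propositional using (_∈_; lose)
open import Data.List.Membership.Propositional.Properties using (∈-lookup; ∈-filter⁺)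
open import Data.List.Properties using (map-++; map-∘; map-tabulate; length-tabulate)
import Data.List.Relation.Unary.All as All
open import Data.List.Relation.Unary.All.Properties using (all-filter)
open import Data.List.Relation.Unary.AllPairs using ([]; _∷_)
open import Data.List.Relation.Unary.Any using (here; there; satisfied; any?)
import Data.List.Relation.Unary.Any as Any
open import Data.List.Relation.Unary.Any.Properties using (lookup-index)
open import Data.List.Relation.Unary.Unique.Propositional using (Unique)
import Data.List.Relation.Unary.Unique.Propositional.Properties as Unique
open import Data.Maybe using (fromMaybe)
open import Data.Nat using (ℕ; zero; suc; 2+; _+_; _*_; _^_; _∸_; _≤_; _/_; _%_)
open import Data.Nat.DivMod using (m*n/n≡m; m*n%n≡0; [m+kn]%n≡m%n)
open import Data.Nat.ListAction using (sum)
open import Data.Nat.ListAction.Properties using (sum-++)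
open import Data.Nat.Properties
open import Data.Nat.Tactic.RingSolver using (solve-∀)
open import Data.Product using (Σ; _×_; _,_; proj₁; proj₂; ∃)
open import Data.Vec using (Vec; []; _∷_; _∷ʳ_; lookup; tabulate)
import Data.Vec as Vec
import Data.Vec.Properties as Vecₚ
open import Data.Vec.Relation.Binary.Pointwise.Extensional using (ext; Pointwise-≡⇒≡)
open import Data.Vec.Relation.Unary.All using (All; all?)
open import Data.Vec.Relation.Unary.All.Properties using (lookup⁺; lookup⁻)
open import Function using (_∘_; id; _⇔_; mk⇔; Equivalence)
open import Function.Construct.Composition using (_⇔-∘_)
open import Function.Construct.Symmetry using (⇔-sym)
open import Relation.Binary.Definitions using (DecidableEquality)
open import Relation.Binary.PropositionalEquality
open import Relation.Nullary using (Dec; yes; no; does; ¬_)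
open import Relation.Nullary.Decidable using (_×-dec_; map′)
open import Relation.Unary using (Decidable; _≐_)

open import Defs

private variable
  A B : Set
  P Q : Set
  n : ℕ

-- Sums and counts over lists

∑ : List A → (A → ℕ) → ℕ
∑ xs F = sum (map F xs)

infix 5 ∑
syntax ∑ xs (λ x → t) = ∑[ x ∈ xs ] t

module _ {F G : A → ℕ} where

  ∑-cong : ∀ xs → (∀ x → F x ≡ G x) → ∑ xs F ≡ ∑ xs G
  ∑-cong []       F≗G = refl
  ∑-cong (x ∷ xs) F≗G = cong₂ _+_ (F≗G x) (∑-cong xs F≗G)

  ∑-+ : ∀ xs → ∑[ x ∈ xs ] (F x + G x) ≡ ∑ xs F + ∑ xs G
  ∑-+ []       = refl
  ∑-+ (x ∷ xs) = trans (cong (F x + G x +_) (∑-+ xs))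
                       (interchange +-commutativeSemigroup (F x) (G x) _ _)

module _ (F : A → ℕ) where

  ∑-++ : ∀ xs ys → ∑ (xs ++ ys) F ≡ ∑ xs F + ∑ ys F
  ∑-++ xs ys = trans (cong sum (map-++ F xs ys)) (sum-++ (map F xs) (map F ys))

  ∑-map : (h : B → A) (xs : List B) → ∑ (map h xs) F ≡ ∑ xs (F ∘ h)
  ∑-map h xs = cong sum (sym (map-∘ xs))

  ∑-concatMap : (h : B → List A) (xs : List B) →
                ∑ (concatMap h xs) F ≡ ∑[ x ∈ xs ] ∑ (h x) F
  ∑-concatMap h []       = refl
  ∑-concatMap h (x ∷ xs) =
    trans (∑-++ (h x) (concatMap h xs)) (cong (∑ (h x) F +_) (∑-concatMap h xs))

  ∑-*ˡ : ∀ c xs → ∑[ x ∈ xs ] c * F x ≡ c * ∑ xs F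
  ∑-*ˡ c []       = sym (*-zeroʳ c)
  ∑-*ˡ c (x ∷ xs) = trans (cong (c * F x +_) (∑-*ˡ c xs)) (sym (*-distribˡ-+ c (F x) _))

  ∑-*ʳ : ∀ c xs → ∑[ x ∈ xs ] F x * c ≡ ∑ xs F * c
  ∑-*ʳ c xs = trans (∑-cong xs (λ x → *-comm (F x) c)) (trans (∑-*ˡ c xs) (*-comm c _))

∑-const : ∀ c (xs : List A) → ∑[ _ ∈ xs ] c ≡ length xs * c
∑-const c []       = refl
∑-const c (x ∷ xs) = cong (c +_) (∑-const c xs)

length≡∑1 : (xs : List A) → length xs ≡ ∑[ _ ∈ xs ] 1
length≡∑1 xs = sym (trans (∑-const 1 xs) (*-identityʳ (length xs)))

∑-zero : (xs : List A) → ∑[ _ ∈ xs ] 0 ≡ 0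
∑-zero xs = trans (∑-const 0 xs) (*-zeroʳ (length xs))

∑-comm : ∀ (xs : List A) (ys : List B) (F : A → B → ℕ) →
         ∑[ x ∈ xs ] ∑[ y ∈ ys ] F x y ≡ ∑[ y ∈ ys ] ∑[ x ∈ xs ] F x y
∑-comm []       ys F = sym (∑-zero ys)
∑-comm (x ∷ xs) ys F =
  trans (cong (∑ ys (F x) +_) (∑-comm xs ys F)) (sym (∑-+ ys))

𝟙 : Dec P → ℕ
𝟙 d = if does d then 1 else 0

𝟙-yes : (d : Dec P) → P → 𝟙 d ≡ 1
𝟙-yes (yes _) _ = refl
𝟙-yes (no ¬p) p = ⊥-elim (¬p p)

𝟙-no : (d : Dec P) → ¬ P → 𝟙 d ≡ 0
𝟙-no (yes p) ¬p = ⊥-elim (¬p p)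
𝟙-no (no _)  _  = refl

𝟙-cong : (d : Dec P) (d′ : Dec Q) → P ⇔ Q → 𝟙 d ≡ 𝟙 d′
𝟙-cong (yes p) d′ P⇔Q = sym (𝟙-yes d′ (Equivalence.to P⇔Q p))
𝟙-cong (no ¬p) d′ P⇔Q = sym (𝟙-no d′ (¬p ∘ Equivalence.from P⇔Q))

𝟙-×-dec : (d : Dec P) (d′ : Dec Q) → 𝟙 (d ×-dec d′) ≡ 𝟙 d * 𝟙 d′
𝟙-×-dec (yes _) d′ = sym (+-identityʳ (𝟙 d′))
𝟙-×-dec (no _)  d′ = refl

Π-⇔ : ∀ {I : Set} {P Q : I → Set} → (∀ i → P i ⇔ Q i) → (∀ i → P i) ⇔ (∀ i → Q i)
Π-⇔ P⇔Q = mk⇔ (λ p i → Equivalence.to (P⇔Q i) (p i)) (λ q i → Equivalence.from (P⇔Q i) (q i))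

count : {P : A → Set} → Decidable P → List A → ℕ
count P? xs = ∑[ x ∈ xs ] 𝟙 (P? x)

module _ {P : A → Set} (P? : Decidable P) where

  ∑-filter : ∀ (F : A → ℕ) xs → ∑ (filter P? xs) F ≡ ∑[ x ∈ xs ] 𝟙 (P? x) * F x
  ∑-filter F []       = refl
  ∑-filter F (x ∷ xs) with P? x
  ... | yes _ = cong₂ _+_ (sym (*-identityˡ (F x))) (∑-filter F xs)
  ... | no  _ = ∑-filter F xs

  length-filter≡count : ∀ xs → length (filter P? xs) ≡ count P? xs
  length-filter≡count xs = begin
    length (filter P? xs)                ≡⟨ sym (*-identityʳ _) ⟩
    length (filter P? xs) * 1            ≡⟨ sym (∑-const 1 (filter P? xs)) ⟩
    ∑[ _ ∈ filter P? xs ] 1              ≡⟨ ∑-filter (λ _ → 1) xs ⟩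
    ∑[ x ∈ xs ] 𝟙 (P? x) * 1             ≡⟨ ∑-cong xs (λ x → *-identityʳ (𝟙 (P? x))) ⟩
    count P? xs                          ∎
    where open ≡-Reasoning

lookup-injective : ∀ {xs : List A} → Unique xs → ∀ i j → List.lookup xs i ≡ List.lookup xs j → i ≡ j
lookup-injective (_    ∷ _) zero    zero    _  = refl
lookup-injective (x≢xs ∷ _) zero    (suc j) eq = ⊥-elim (All.lookup x≢xs (∈-lookup j) eq)
lookup-injective (x≢xs ∷ _) (suc i) zero    eq = ⊥-elim (All.lookup x≢xs (∈-lookup i) (sym eq))
lookup-injective (_ ∷ uniq) (suc i) (suc j) eq = cong suc (lookup-injective uniq i j eq)

-- Enumerations

module Enumeration (_≟_ : DecidableEquality A) where

  count≡1⇒∈ : ∀ {z} xs → count (_≟ z) xs ≡ 1 → z ∈ xs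
  count≡1⇒∈ {z} (x ∷ xs) c≡1 with x ≟ z
  ... | yes refl = here refl
  ... | no  _    = there (count≡1⇒∈ xs c≡1)

  1≤𝟙[x≟x] : ∀ x → 1 ≤ 𝟙 (x ≟ x)
  1≤𝟙[x≟x] x = ≤-reflexive (sym (𝟙-yes (x ≟ x) refl))

  ∈⇒1≤count : ∀ {z xs} → z ∈ xs → 1 ≤ count (_≟ z) xs
  ∈⇒1≤count {xs = x ∷ _} (here refl)  = ≤-trans (1≤𝟙[x≟x] x) (m≤m+n _ _)
  ∈⇒1≤count               (there z∈xs) = ≤-trans (∈⇒1≤count z∈xs) (m≤n+m _ _)

  count≤1⇒unique : ∀ xs → (∀ z → count (_≟ z) xs ≤ 1) → Unique xs
  count≤1⇒unique []       _   = []
  count≤1⇒unique (x ∷ xs) ≤1 =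
    All.tabulate x∉ ∷ count≤1⇒unique xs (λ z → ≤-trans (m≤n+m _ _) (≤1 z))
    where
    x∉ : ∀ {y} → y ∈ xs → x ≢ y
    x∉ y∈xs refl = <-irrefl refl (≤-trans (+-mono-≤ (1≤𝟙[x≟x] x) (∈⇒1≤count y∈xs)) (≤1 x))

  IsEnumeration : List A → Set
  IsEnumeration xs = ∀ z → count (_≟ z) xs ≡ 1

  module _ (xs : List A) (enum : IsEnumeration xs) where

    ∑-select : ∀ z (F : A → ℕ) → ∑[ y ∈ xs ] 𝟙 (y ≟ z) * F y ≡ F z
    ∑-select z F = begin
      ∑[ y ∈ xs ] 𝟙 (y ≟ z) * F y  ≡⟨ ∑-cong xs move ⟩
      ∑[ y ∈ xs ] 𝟙 (y ≟ z) * F z  ≡⟨ ∑-*ʳ (λ y → 𝟙 (y ≟ z)) (F z) xs ⟩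
      count (_≟ z) xs * F z        ≡⟨ cong (_* F z) (enum z) ⟩
      1 * F z                      ≡⟨ *-identityˡ (F z) ⟩
      F z                          ∎
      where
      open ≡-Reasoning
      move : ∀ y → 𝟙 (y ≟ z) * F y ≡ 𝟙 (y ≟ z) * F z
      move y with y ≟ z
      ... | yes refl = refl
      ... | no  _    = refl

    ∑-reindex : ∀ (σ : A → A) → Involutive _≡_ σ → ∀ F → ∑[ x ∈ xs ] F (σ x) ≡ ∑ xs F
    ∑-reindex σ σ-inv F = begin
      ∑[ x ∈ xs ] F (σ x)
        ≡⟨ ∑-cong xs (λ x → sym (∑-select (σ x) F)) ⟩
      ∑[ x ∈ xs ] ∑[ y ∈ xs ] 𝟙 (y ≟ σ x) * F y
        ≡⟨ ∑-comm xs xs _ ⟩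
      ∑[ y ∈ xs ] ∑[ x ∈ xs ] 𝟙 (y ≟ σ x) * F y
        ≡⟨ ∑-cong xs (λ y → ∑-cong xs (λ x → cong (_* F y) (swap y x))) ⟩
      ∑[ y ∈ xs ] ∑[ x ∈ xs ] 𝟙 (x ≟ σ y) * F y
        ≡⟨ ∑-cong xs (λ y → ∑-select (σ y) (λ _ → F y)) ⟩
      ∑ xs F ∎
      where
      open ≡-Reasoning
      swap : ∀ y x → 𝟙 (y ≟ σ x) ≡ 𝟙 (x ≟ σ y)
      swap y x = 𝟙-cong (y ≟ σ x) (x ≟ σ y) (mk⇔ (λ eq → trans (sym (σ-inv x)) (cong σ (sym eq)))
                                                  (λ eq → trans (sym (σ-inv y)) (cong σ (sym eq))))

    ∈-enumeration : ∀ z → z ∈ xs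
    ∈-enumeration z = count≡1⇒∈ xs (enum z)

    enumeration-unique : Unique xs
    enumeration-unique = count≤1⇒unique xs (λ z → ≤-reflexive (enum z))

module _ {P : A → Set} (P? : Decidable P) where

  fromMaybe-find : ∀ {d} xs → P d → P (fromMaybe d (find P? xs))
  fromMaybe-find []       pd = pd
  fromMaybe-find (x ∷ xs) pd with P? x
  ... | yes px = px
  ... | no  _  = fromMaybe-find xs pd

  fromMaybe-find-irrelevant : ∀ {x xs d d′} → x ∈ xs → P x →
                              fromMaybe d (find P? xs) ≡ fromMaybe d′ (find P? xs)
  fromMaybe-find-irrelevant {xs = x ∷ _} (here refl) px with P? x
  ... | yes _  = refl
  ... | no ¬px = ⊥-elim (¬px px)
  fromMaybe-find-irrelevant {xs = y ∷ _} (there x∈xs) px with P? y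
  ... | yes _ = refl
  ... | no  _ = fromMaybe-find-irrelevant x∈xs px

  find-≐ : ∀ {Q : A → Set} (Q? : Decidable Q) → P ≐ Q → ∀ xs → find P? xs ≡ find Q? xs
  find-≐ Q? P≐Q []       = refl
  find-≐ Q? P≐Q (x ∷ xs) with P? x | Q? x
  ... | yes _  | yes _  = refl
  ... | no  _  | no  _  = find-≐ Q? P≐Q xs
  ... | yes px | no ¬qx = ⊥-elim (¬qx (proj₁ P≐Q px))
  ... | no ¬px | yes qx = ⊥-elim (¬px (proj₂ P≐Q qx))

open Enumeration using (IsEnumeration; ∑-select; ∑-reindex; ∈-enumeration; enumeration-unique)

∑-tabulate-suc : ∀ {k} (F : Fin (suc k) → ℕ) → ∑ (List.tabulate suc) F ≡ ∑[ y ∈ allFin k ] F (suc y)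
∑-tabulate-suc F = trans (cong sum (map-tabulate suc F)) (sym (cong sum (map-tabulate id (F ∘ suc))))

allFin-enumeration : ∀ k → IsEnumeration Fin._≟_ (allFin k)
allFin-enumeration (suc k) zero = cong suc (begin
  ∑[ y ∈ List.tabulate {n = k} suc ] 𝟙 (y Fin.≟ zero)
    ≡⟨ ∑-tabulate-suc {k = k} (λ y → 𝟙 (y Fin.≟ zero)) ⟩
  ∑[ y ∈ allFin k ] 0
    ≡⟨ ∑-zero (allFin k) ⟩
  0 ∎)
  where open ≡-Reasoning
allFin-enumeration (suc k) (suc i) =
  trans (∑-tabulate-suc (λ y → 𝟙 (y Fin.≟ suc i))) (allFin-enumeration k i)

module _ (xs : List A) where

  ∑-allVecs-∷ : ∀ n (F : Vec A (suc n) → ℕ) →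
                ∑ (allVecs xs (suc n)) F ≡ ∑[ a ∈ xs ] ∑[ w ∈ allVecs xs n ] F (a ∷ w)
  ∑-allVecs-∷ n F = trans (∑-concatMap F (λ a → map (a ∷_) (allVecs xs n)) xs)
                          (∑-cong xs (λ a → ∑-map F (a ∷_) (allVecs xs n)))

  ∑-allVecs-∷ʳ : ∀ n (F : Vec A (suc n) → ℕ) →
                 ∑ (allVecs xs (suc n)) F ≡ ∑[ b ∈ xs ] ∑[ w ∈ allVecs xs n ] F (w ∷ʳ b)
  ∑-allVecs-∷ʳ zero    F = ∑-allVecs-∷ zero F
  ∑-allVecs-∷ʳ (suc n) F = begin
    ∑ (allVecs xs (2+ n)) F
      ≡⟨ ∑-allVecs-∷ (suc n) F ⟩
    ∑[ a ∈ xs ] ∑[ u ∈ allVecs xs (suc n) ] F (a ∷ u)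
      ≡⟨ ∑-cong xs (λ a → ∑-allVecs-∷ʳ n (F ∘ (a ∷_))) ⟩
    ∑[ a ∈ xs ] ∑[ b ∈ xs ] ∑[ w ∈ allVecs xs n ] F (a ∷ (w ∷ʳ b))
      ≡⟨ ∑-comm xs xs _ ⟩
    ∑[ b ∈ xs ] ∑[ a ∈ xs ] ∑[ w ∈ allVecs xs n ] F (a ∷ (w ∷ʳ b))
      ≡⟨ ∑-cong xs (λ b → sym (∑-allVecs-∷ n (F ∘ (_∷ʳ b)))) ⟩
    ∑[ b ∈ xs ] ∑[ w ∈ allVecs xs (suc n) ] F (w ∷ʳ b) ∎
    where open ≡-Reasoning

  length-allVecs : ∀ n → length (allVecs xs n) ≡ length xs ^ n
  length-allVecs zero    = refl
  length-allVecs (suc n) = begin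
    length (allVecs xs (suc n))
      ≡⟨ length≡∑1 (allVecs xs (suc n)) ⟩
    ∑[ v ∈ allVecs xs (suc n) ] 1
      ≡⟨ ∑-allVecs-∷ n (λ _ → 1) ⟩
    ∑[ a ∈ xs ] ∑[ w ∈ allVecs xs n ] 1
      ≡⟨ ∑-cong xs (λ _ → trans (sym (length≡∑1 (allVecs xs n))) (length-allVecs n)) ⟩
    ∑[ a ∈ xs ] length xs ^ n
      ≡⟨ ∑-const (length xs ^ n) xs ⟩
    length xs * length xs ^ n ∎
    where open ≡-Reasoning

  count-All : ∀ {P : A → Set} (P? : Decidable P) n → count (all? P?) (allVecs xs n) ≡ count P? xs ^ n
  count-All P? zero    = refl
  count-All P? (suc n) = begin
    count (all? P?) (allVecs xs (suc n))
      ≡⟨ ∑-allVecs-∷ n (λ v → 𝟙 (all? P? v)) ⟩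
    ∑[ a ∈ xs ] ∑[ w ∈ allVecs xs n ] 𝟙 (all? P? (a ∷ w))
      ≡⟨ ∑-cong xs (λ a → ∑-cong (allVecs xs n) (λ w → 𝟙-×-dec (P? a) (all? P? w))) ⟩
    ∑[ a ∈ xs ] ∑[ w ∈ allVecs xs n ] 𝟙 (P? a) * 𝟙 (all? P? w)
      ≡⟨ ∑-cong xs (λ a → ∑-*ˡ (λ w → 𝟙 (all? P? w)) (𝟙 (P? a)) (allVecs xs n)) ⟩
    ∑[ a ∈ xs ] 𝟙 (P? a) * count (all? P?) (allVecs xs n)
      ≡⟨ ∑-cong xs (λ a → cong (𝟙 (P? a) *_) (count-All P? n)) ⟩
    ∑[ a ∈ xs ] 𝟙 (P? a) * count P? xs ^ n
      ≡⟨ ∑-*ʳ (λ a → 𝟙 (P? a)) (count P? xs ^ n) xs ⟩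
    count P? xs * count P? xs ^ n ∎
    where open ≡-Reasoning

allVecs-enumeration : ∀ (_≟_ : DecidableEquality A) {xs} → IsEnumeration _≟_ xs →
                      ∀ n → IsEnumeration (Vecₚ.≡-dec _≟_) (allVecs xs n)
allVecs-enumeration _≟_      enum zero    []      = refl
allVecs-enumeration _≟_ {xs} enum (suc n) (a ∷ v) = begin
  count (_≡? (a ∷ v)) (allVecs xs (suc n))
    ≡⟨ ∑-allVecs-∷ xs n (λ u → 𝟙 (u ≡? (a ∷ v))) ⟩
  ∑[ b ∈ xs ] ∑[ w ∈ allVecs xs n ] 𝟙 ((b ∷ w) ≡? (a ∷ v))
    ≡⟨ ∑-cong xs (λ b → ∑-cong (allVecs xs n) (λ w → 𝟙-×-dec (b ≟ a) (w ≡? v))) ⟩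
  ∑[ b ∈ xs ] ∑[ w ∈ allVecs xs n ] 𝟙 (b ≟ a) * 𝟙 (w ≡? v)
    ≡⟨ ∑-cong xs (λ b → ∑-*ˡ (λ w → 𝟙 (w ≡? v)) (𝟙 (b ≟ a)) (allVecs xs n)) ⟩
  ∑[ b ∈ xs ] 𝟙 (b ≟ a) * count (_≡? v) (allVecs xs n)
    ≡⟨ ∑-cong xs (λ b → cong (𝟙 (b ≟ a) *_) (allVecs-enumeration _≟_ enum n v)) ⟩
  ∑[ b ∈ xs ] 𝟙 (b ≟ a) * 1
    ≡⟨ ∑-select _≟_ xs enum a (λ _ → 1) ⟩
  1 ∎
  where
  open ≡-Reasoning
  _≡?_ : ∀ {n} → DecidableEquality (Vec _ n)
  _≡?_ = Vecₚ.≡-dec _≟_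

-- Twisted palindromes

opposite-fromℕ : ∀ n → opposite (fromℕ n) ≡ zero
opposite-fromℕ zero    = refl
opposite-fromℕ (suc n) = cong inject₁ (opposite-fromℕ n)

opposite-inject₁ : ∀ {n} (i : Fin n) → opposite (inject₁ i) ≡ suc (opposite i)
opposite-inject₁ {suc n} zero    = refl
opposite-inject₁ {suc n} (suc i) = cong inject₁ (opposite-inject₁ i)

lookup-∷ʳ-inject₁ : ∀ {n} (w : Vec A n) b i → lookup (w ∷ʳ b) (inject₁ i) ≡ lookup w i
lookup-∷ʳ-inject₁ (x ∷ w) b zero    = refl
lookup-∷ʳ-inject₁ (x ∷ w) b (suc i) = lookup-∷ʳ-inject₁ w b i

lookup-∷ʳ-fromℕ : ∀ {n} (w : Vec A n) b → lookup (w ∷ʳ b) (fromℕ n) ≡ b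
lookup-∷ʳ-fromℕ []      b = refl
lookup-∷ʳ-fromℕ (x ∷ w) b = lookup-∷ʳ-fromℕ w b

Palindrome : (A → A) → Vec A n → Set
Palindrome σ v = ∀ i → lookup v (opposite i) ≡ σ (lookup v i)

palindrome? : DecidableEquality A → (σ : A → A) → Decidable (Palindrome {n = n} σ)
palindrome? _≟_ σ v = Fin.all? (λ i → lookup v (opposite i) ≟ σ (lookup v i))

module _ (σ : A → A) (σ-inv : Involutive _≡_ σ) where

  palindrome-∷-∷ʳ : ∀ {n} a (w : Vec A n) b →
                    Palindrome σ (a ∷ (w ∷ʳ b)) ⇔ (b ≡ σ a × Palindrome σ w)
  palindrome-∷-∷ʳ {n} a w b =
    mk⇔ (λ pal → outer pal , inner pal) (λ (b≡σa , pal) → extend b≡σa pal)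
    where
    v : Vec A (2+ n)
    v = a ∷ (w ∷ʳ b)
    outer : Palindrome σ v → b ≡ σ a
    outer pal = trans (sym (lookup-∷ʳ-fromℕ w b)) (pal zero)
    inner : Palindrome σ v → Palindrome σ w
    inner pal i = begin
      lookup w (opposite i)
        ≡⟨ lookup-∷ʳ-inject₁ w b (opposite i) ⟨
      lookup v (suc (inject₁ (opposite i)))
        ≡⟨ cong (lookup v) (cong inject₁ (opposite-inject₁ i)) ⟨
      lookup v (opposite (suc (inject₁ i)))
        ≡⟨ pal (suc (inject₁ i)) ⟩
      σ (lookup (w ∷ʳ b) (inject₁ i))
        ≡⟨ cong σ (lookup-∷ʳ-inject₁ w b i) ⟩
      σ (lookup w i) ∎
      where open ≡-Reasoning
    extend : b ≡ σ a → Palindrome σ w → Palindrome σ v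
    extend b≡σa pal zero = trans (lookup-∷ʳ-fromℕ w b) b≡σa
    extend b≡σa pal (suc j) with view j
    ... | ‵fromℕ = begin
      lookup v (inject₁ (opposite (fromℕ n)))
        ≡⟨ cong (lookup v ∘ inject₁) (opposite-fromℕ n) ⟩
      a
        ≡⟨ σ-inv a ⟨
      σ (σ a)
        ≡⟨ cong σ (trans (sym b≡σa) (sym (lookup-∷ʳ-fromℕ w b))) ⟩
      σ (lookup (w ∷ʳ b) (fromℕ n)) ∎
      where open ≡-Reasoning
    ... | ‵inject₁ i = begin
      lookup v (inject₁ (opposite (inject₁ i))) ≡⟨ cong (lookup v ∘ inject₁) (opposite-inject₁ i) ⟩
      lookup (w ∷ʳ b) (inject₁ (opposite i))    ≡⟨ lookup-∷ʳ-inject₁ w b (opposite i) ⟩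
      lookup w (opposite i)                     ≡⟨ pal i ⟩
      σ (lookup w i)                            ≡⟨ cong σ (lookup-∷ʳ-inject₁ w b i) ⟨
      σ (lookup (w ∷ʳ b) (inject₁ i))           ∎
      where open ≡-Reasoning

module PalindromeCount (_≟_ : DecidableEquality A) (σ : A → A) (σ-inv : Involutive _≡_ σ)
                       (xs : List A) (enum : IsEnumeration _≟_ xs) where

  private
    pal? : ∀ {n} → Decidable (Palindrome {n = n} σ)
    pal? = palindrome? _≟_ σ

  #palindromes : ℕ → ℕ
  #palindromes n = count (pal? {n}) (allVecs xs n)

  #palindromes-2+ : ∀ n → #palindromes (2+ n) ≡ length xs * #palindromes n
  #palindromes-2+ n = begin
    #palindromes (2+ n)
      ≡⟨ ∑-allVecs-∷ xs (suc n) (𝟙 ∘ pal?) ⟩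
    ∑[ a ∈ xs ] ∑[ u ∈ allVecs xs (suc n) ] 𝟙 (pal? (a ∷ u))
      ≡⟨ ∑-cong xs (λ a → ∑-allVecs-∷ʳ xs n (λ u → 𝟙 (pal? (a ∷ u)))) ⟩
    ∑[ a ∈ xs ] ∑[ b ∈ xs ] ∑[ w ∈ allVecs xs n ] 𝟙 (pal? (a ∷ (w ∷ʳ b)))
      ≡⟨ ∑-cong xs (λ a → ∑-cong xs (λ b → ∑-cong (allVecs xs n) (λ w → split a w b))) ⟩
    ∑[ a ∈ xs ] ∑[ b ∈ xs ] ∑[ w ∈ allVecs xs n ] 𝟙 (b ≟ σ a) * 𝟙 (pal? w)
      ≡⟨ ∑-cong xs (λ a → ∑-cong xs (λ b → ∑-*ˡ (𝟙 ∘ pal?) (𝟙 (b ≟ σ a)) (allVecs xs n))) ⟩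
    ∑[ a ∈ xs ] ∑[ b ∈ xs ] 𝟙 (b ≟ σ a) * #palindromes n
      ≡⟨ ∑-cong xs (λ a → ∑-select _≟_ xs enum (σ a) (λ _ → #palindromes n)) ⟩
    ∑[ a ∈ xs ] #palindromes n
      ≡⟨ ∑-const (#palindromes n) xs ⟩
    length xs * #palindromes n ∎
    where
    open ≡-Reasoning
    split : ∀ a (w : Vec A n) b → 𝟙 (pal? (a ∷ (w ∷ʳ b))) ≡ 𝟙 (b ≟ σ a) * 𝟙 (pal? w)
    split a w b =
      trans (𝟙-cong (pal? (a ∷ (w ∷ʳ b))) (b ≟ σ a ×-dec pal? w) (palindrome-∷-∷ʳ σ σ-inv a w b))
            (𝟙-×-dec (b ≟ σ a) (pal? w))

  #palindromes-even : ∀ q → #palindromes (q * 2) ≡ length xs ^ q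
  #palindromes-even zero    = 𝟙-yes (pal? []) (λ ())
  #palindromes-even (suc q) = trans (#palindromes-2+ (q * 2)) (cong (length xs *_) (#palindromes-even q))

  #palindromes-odd : ∀ q → #palindromes (1 + q * 2) ≡ length xs ^ q * count (λ a → a ≟ σ a) xs
  #palindromes-odd zero    = begin
    #palindromes 1
      ≡⟨ ∑-allVecs-∷ xs 0 (𝟙 ∘ pal?) ⟩
    ∑[ a ∈ xs ] (𝟙 (pal? (a ∷ [])) + 0)
      ≡⟨ ∑-cong xs (λ a → trans (+-identityʳ _) (𝟙-cong (pal? (a ∷ [])) (a ≟ σ a) singleton)) ⟩
    count (λ a → a ≟ σ a) xs
      ≡⟨ *-identityˡ _ ⟨
    1 * count (λ a → a ≟ σ a) xs ∎
    where
    open ≡-Reasoning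
    singleton : ∀ {a} → Palindrome σ (a ∷ []) ⇔ (a ≡ σ a)
    singleton = mk⇔ (λ pal → pal zero) (λ { a≡σa zero → a≡σa })
  #palindromes-odd (suc q) = begin
    #palindromes (2+ (1 + q * 2))
      ≡⟨ #palindromes-2+ (1 + q * 2) ⟩
    length xs * #palindromes (1 + q * 2)
      ≡⟨ cong (length xs *_) (#palindromes-odd q) ⟩
    length xs * (length xs ^ q * count (λ a → a ≟ σ a) xs)
      ≡⟨ *-assoc (length xs) _ _ ⟨
    length xs ^ suc q * count (λ a → a ≟ σ a) xs ∎
    where open ≡-Reasoning

module _ (σ : A → A) where

  ≡-map⇔ : ∀ (u v : Vec A n) → (v ≡ Vec.map σ u) ⇔ (∀ i → lookup v i ≡ σ (lookup u i))
  ≡-map⇔ u v = mk⇔ (λ v≡ i → trans (cong (λ w → lookup w i) v≡) (Vecₚ.lookup-map i σ u))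
                   (λ h → Pointwise-≡⇒≡ (ext (λ i → trans (h i) (sym (Vecₚ.lookup-map i σ u)))))

  map-involutive : Involutive _≡_ σ → Involutive _≡_ (Vec.map {n = n} σ)
  map-involutive σ-inv v =
    trans (sym (Vecₚ.map-∘ σ σ v)) (trans (Vecₚ.map-cong σ-inv v) (Vecₚ.map-id v))

  reverseMap : Vec A n → Vec A n
  reverseMap v = tabulate (λ i → σ (lookup v (opposite i)))

  ≡-reverseMap⇔ : ∀ (u v : Vec A n) →
                  (v ≡ reverseMap u) ⇔ (∀ i → lookup v (opposite i) ≡ σ (lookup u i))
  ≡-reverseMap⇔ u v = mk⇔ to from
    where
    to : v ≡ reverseMap u → ∀ i → lookup v (opposite i) ≡ σ (lookup u i)
    to refl i =
      trans (Vecₚ.lookup∘tabulate _ (opposite i)) (cong (σ ∘ lookup u) (Fin.opposite-involutive i))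
    from : (∀ i → lookup v (opposite i) ≡ σ (lookup u i)) → v ≡ reverseMap u
    from h = Pointwise-≡⇒≡ (ext (λ i → begin
      lookup v i                      ≡⟨ cong (lookup v) (Fin.opposite-involutive i) ⟨
      lookup v (opposite (opposite i)) ≡⟨ h (opposite i) ⟩
      σ (lookup u (opposite i))        ≡⟨ Vecₚ.lookup∘tabulate _ i ⟨
      lookup (reverseMap u) i          ∎))
      where open ≡-Reasoning

  reverseMap-involutive : Involutive _≡_ σ → Involutive _≡_ (reverseMap {n = n})
  reverseMap-involutive σ-inv v = sym (Equivalence.from (≡-reverseMap⇔ (reverseMap v) v) twice)
    where
    twice : ∀ i → lookup v (opposite i) ≡ σ (lookup (reverseMap v) i)
    twice i = trans (sym (σ-inv _)) (cong σ (sym (Vecₚ.lookup∘tabulate _ i)))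

-- The group D4

·-cancelʳ : ∀ g h → (g · h) · h ≡ g
·-cancelʳ e   e   = refl
·-cancelʳ e   r2  = refl
·-cancelʳ e   f   = refl
·-cancelʳ e   r2f = refl
·-cancelʳ r2  e   = refl
·-cancelʳ r2  r2  = refl
·-cancelʳ r2  f   = refl
·-cancelʳ r2  r2f = refl
·-cancelʳ f   e   = refl
·-cancelʳ f   r2  = refl
·-cancelʳ f   f   = refl
·-cancelʳ f   r2f = refl
·-cancelʳ r2f e   = refl
·-cancelʳ r2f r2  = refl
·-cancelʳ r2f f   = refl
·-cancelʳ r2f r2f = refl

·-selfInverse : ∀ g → g · g ≡ e
·-selfInverse = ·-cancelʳ e

_≟D4_ : DecidableEquality D4
e   ≟D4 e   = yes refl
e   ≟D4 r2  = no λ ()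
e   ≟D4 f   = no λ ()
e   ≟D4 r2f = no λ ()
r2  ≟D4 e   = no λ ()
r2  ≟D4 r2  = yes refl
r2  ≟D4 f   = no λ ()
r2  ≟D4 r2f = no λ ()
f   ≟D4 e   = no λ ()
f   ≟D4 r2  = no λ ()
f   ≟D4 f   = yes refl
f   ≟D4 r2f = no λ ()
r2f ≟D4 e   = no λ ()
r2f ≟D4 r2  = no λ ()
r2f ≟D4 f   = no λ ()
r2f ≟D4 r2f = yes refl

allD4-enumeration : IsEnumeration _≟D4_ allD4
allD4-enumeration e   = refl
allD4-enumeration r2  = refl
allD4-enumeration f   = refl
allD4-enumeration r2f = refl

cellAct-· : ∀ {n m} (c : Cell n m) g h → cellAct (cellAct c h) g ≡ cellAct c (g · h)
cellAct-· c       e   h   = refl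
cellAct-· c       r2  e   = refl
cellAct-· (x , y) r2  r2  = cong₂ _,_ (Fin.opposite-involutive x) (Fin.opposite-involutive y)
cellAct-· (x , y) r2  f   = cong₂ _,_ (Fin.opposite-involutive x) refl
cellAct-· (x , y) r2  r2f = cong₂ _,_ refl (Fin.opposite-involutive y)
cellAct-· c       f   e   = refl
cellAct-· (x , y) f   r2  = cong₂ _,_ (Fin.opposite-involutive x) refl
cellAct-· (x , y) f   f   = cong₂ _,_ (Fin.opposite-involutive x) refl
cellAct-· (x , y) f   r2f = refl
cellAct-· c       r2f e   = refl
cellAct-· (x , y) r2f r2  = cong₂ _,_ refl (Fin.opposite-involutive y)
cellAct-· (x , y) r2f f   = refl
cellAct-· (x , y) r2f r2f = cong₂ _,_ refl (Fin.opposite-involutive y)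

cellAct-selfInverse : ∀ {n m} (c : Cell n m) g → cellAct (cellAct c g) g ≡ c
cellAct-selfInverse (x , y) g = trans (cellAct-· (x , y) g g) (cong (cellAct (x , y)) (·-selfInverse g))

-- Fixed tilings

data EvenOdd : ℕ → Set where
  even : ∀ q → EvenOdd (q * 2)
  odd  : ∀ q → EvenOdd (1 + q * 2)

evenOdd : ∀ n → EvenOdd n
evenOdd zero          = even 0
evenOdd (suc zero)    = odd 0
evenOdd (suc (suc n)) with evenOdd n
... | even q = even (suc q)
... | odd  q = odd (suc q)

half : ∀ c {x} → x ≡ c * 2 → x / 2 ≡ c
half c refl = m*n/n≡m c 2

even⇒%2≢1 : ∀ c {x} → x ≡ c * 2 → x % 2 ≢ 1
even⇒%2≢1 c refl = 0≢1+n ∘ trans (sym (m*n%n≡0 c 2))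

odd⇒%2≢0 : ∀ c {x} → x ≡ 1 + c * 2 → x % 2 ≢ 0
odd⇒%2≢0 c refl = 1+n≢0 ∘ trans (sym ([m+kn]%n≡m%n 1 c 2))

^-distrib-* : ∀ x y n → (x * y) ^ n ≡ x ^ n * y ^ n
^-distrib-* x y zero    = refl
^-distrib-* x y (suc n) = trans (cong (x * y *_) (^-distrib-* x y n))
                                (interchange *-commutativeSemigroup x y (x ^ n) (y ^ n))

[q*2]*m≡[m*q]*2 : ∀ q m → q * 2 * m ≡ m * q * 2
[q*2]*m≡[m*q]*2 = solve-∀

n*[b*2]≡[b*n]*2 : ∀ n b → n * (b * 2) ≡ b * n * 2
n*[b*2]≡[b*n]*2 = solve-∀

[1+q*2]*[b*2]≡[b*2*q+b]*2 : ∀ q b → (1 + q * 2) * (b * 2) ≡ (b * 2 * q + b) * 2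
[1+q*2]*[b*2]≡[b*2*q+b]*2 = solve-∀

[1+q*2]*[1+b*2]≡1+[[1+b*2]*q+b]*2 : ∀ q b → (1 + q * 2) * (1 + b * 2) ≡ 1 + ((1 + b * 2) * q + b) * 2
[1+q*2]*[1+b*2]≡1+[[1+b*2]*q+b]*2 = solve-∀

module _ {R : Subgroup} (T : TileDesigns R) where

  actBy : D4 → Fin (k T) → Fin (k T)
  actBy g d = act T d g

  actBy-involutive : ∀ {g} → mem R g ≡ true → Involutive _≡_ (actBy g)
  actBy-involutive {g} g∈R d = begin
    act T (act T d g) g  ≡⟨ act-· T d g g g∈R g∈R ⟩
    act T d (g · g)      ≡⟨ cong (act T d) (·-selfInverse g) ⟩
    act T d e            ≡⟨ act-e T d ⟩
    d                    ∎
    where open ≡-Reasoning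

  designs : List (Fin (k T))
  designs = allFin (k T)

  length-designs : length designs ≡ k T
  length-designs = length-tabulate id

  tfix≡count : ∀ g → tfix T g ≡ count (λ d → d Fin.≟ actBy g d) designs
  tfix≡count g =
    trans (length-filter≡count (λ d → actBy g d Fin.≟ d) designs)
          (∑-cong designs (λ d → 𝟙-cong (actBy g d Fin.≟ d) (d Fin.≟ actBy g d) (mk⇔ sym sym)))

  tfix-e : tfix T e ≡ k T
  tfix-e = begin
    tfix T e
      ≡⟨ length-filter≡count (λ d → act T d e Fin.≟ d) designs ⟩
    count (λ d → act T d e Fin.≟ d) designs
      ≡⟨ ∑-cong designs (λ d → 𝟙-yes (act T d e Fin.≟ d) (act-e T d)) ⟩
    ∑[ _ ∈ designs ] 1
      ≡⟨ length≡∑1 designs ⟨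
    length designs
      ≡⟨ length-designs ⟩
    k T ∎
    where open ≡-Reasoning

  tfix-e^half : ∀ c {x} → x ≡ c * 2 → k T ^ c ≡ tfix T e ^ (x / 2)
  tfix-e^half c x≡ = cong₂ _^_ (sym tfix-e) (sym (half c x≡))

  Row : ℕ → Set
  Row m = Vec (Fin (k T)) m

  rows : ∀ m → List (Row m)
  rows m = allVecs designs m

  _≟Row_ : ∀ {m} → DecidableEquality (Row m)
  _≟Row_ = Vecₚ.≡-dec Fin._≟_

  rows-enumeration : ∀ {m} → IsEnumeration _≟Row_ (rows m)
  rows-enumeration {m} = allVecs-enumeration Fin._≟_ (allFin-enumeration (k T)) m

  length-rows : ∀ m → length (rows m) ≡ k T ^ m
  length-rows m = trans (length-allVecs designs m) (cong (_^ m) length-designs)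

  Fix-cong : ∀ {n m g} {Q : Tiling n m (k T) → Set} (Q? : Decidable Q) →
             (∀ τ → FixedBy T g τ ⇔ Q τ) → Fix T n m g ≡ count Q? (allVecs (rows m) n)
  Fix-cong {n} {m} {g} Q? fixedBy⇔Q =
    trans (length-filter≡count (fixedBy? T g) (allVecs (rows m) n))
          (∑-cong (allVecs (rows m) n) (λ τ → 𝟙-cong (fixedBy? T g τ) (Q? τ) (fixedBy⇔Q τ)))

  Fix-e : ∀ n m → Fix T n m e ≡ tfix T e ^ (n * m)
  Fix-e n m = begin
    Fix T n m e
      ≡⟨ length-filter≡count (fixedBy? T e) tilings ⟩
    count (fixedBy? T e) tilings
      ≡⟨ ∑-cong tilings (λ τ → 𝟙-yes (fixedBy? T e τ) (λ x y → sym (act-e T _))) ⟩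
    ∑[ _ ∈ tilings ] 1
      ≡⟨ length≡∑1 tilings ⟨
    length tilings
      ≡⟨ length-allVecs (rows m) n ⟩
    length (rows m) ^ n
      ≡⟨ cong (_^ n) (length-rows m) ⟩
    (k T ^ m) ^ n
      ≡⟨ ^-*-assoc (k T) m n ⟩
    k T ^ (m * n)
      ≡⟨ cong₂ _^_ (sym tfix-e) (*-comm m n) ⟩
    tfix T e ^ (n * m) ∎
    where
    open ≡-Reasoning
    tilings : List (Tiling n m (k T))
    tilings = allTilings n m (k T)

  module RowPalindromes {m} (ρ : Row m → Row m) (ρ-inv : Involutive _≡_ ρ) {g}
                        (fixedBy⇔ : ∀ {n} (τ : Tiling n m (k T)) → FixedBy T g τ ⇔ Palindrome ρ τ) where

    open PalindromeCount _≟Row_ ρ ρ-inv (rows m) rows-enumeration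

    Fix-even : ∀ q → Fix T (q * 2) m g ≡ k T ^ (m * q)
    Fix-even q = begin
      Fix T (q * 2) m g       ≡⟨ Fix-cong {n = q * 2} (palindrome? _≟Row_ ρ) fixedBy⇔ ⟩
      #palindromes (q * 2)    ≡⟨ #palindromes-even q ⟩
      length (rows m) ^ q     ≡⟨ cong (_^ q) (length-rows m) ⟩
      (k T ^ m) ^ q           ≡⟨ ^-*-assoc (k T) m q ⟩
      k T ^ (m * q)           ∎
      where open ≡-Reasoning

    #fixedRows : ℕ
    #fixedRows = count (λ v → v ≟Row ρ v) (rows m)

    Fix-odd : ∀ q → Fix T (1 + q * 2) m g ≡ k T ^ (m * q) * #fixedRows
    Fix-odd q = begin
      Fix T (1 + q * 2) m g
        ≡⟨ Fix-cong {n = 1 + q * 2} (palindrome? _≟Row_ ρ) fixedBy⇔ ⟩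
      #palindromes (1 + q * 2)
        ≡⟨ #palindromes-odd q ⟩
      length (rows m) ^ q * #fixedRows
        ≡⟨ cong (λ l → l ^ q * #fixedRows) (length-rows m) ⟩
      (k T ^ m) ^ q * #fixedRows
        ≡⟨ cong (_* #fixedRows) (^-*-assoc (k T) m q) ⟩
      k T ^ (m * q) * #fixedRows ∎
      where open ≡-Reasoning

  module DesignPalindromes {g} (g∈R : mem R g ≡ true) where

    open PalindromeCount Fin._≟_ (actBy g) (actBy-involutive g∈R) designs (allFin-enumeration (k T)) public

    #palindromes≡k^ : ∀ b → #palindromes (b * 2) ≡ k T ^ b
    #palindromes≡k^ b = trans (#palindromes-even b) (cong (_^ b) length-designs)

    #palindromes≡k^*tfix : ∀ b → #palindromes (1 + b * 2) ≡ k T ^ b * tfix T g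
    #palindromes≡k^*tfix b =
      trans (#palindromes-odd b) (cong₂ (λ l t → l ^ b * t) length-designs (sym (tfix≡count g)))

  fixedBy-f⇔ : ∀ {n m} (τ : Tiling n m (k T)) → FixedBy T f τ ⇔ Palindrome (Vec.map (actBy f)) τ
  fixedBy-f⇔ τ = Π-⇔ (λ x → ⇔-sym (≡-map⇔ (actBy f) (lookup τ x) (lookup τ (opposite x))))

  fixedBy-r2⇔ : ∀ {n m} (τ : Tiling n m (k T)) → FixedBy T r2 τ ⇔ Palindrome (reverseMap (actBy r2)) τ
  fixedBy-r2⇔ τ = Π-⇔ (λ x → ⇔-sym (≡-reverseMap⇔ (actBy r2) (lookup τ x) (lookup τ (opposite x))))

  fixedBy-r2f⇔ : ∀ {n m} (τ : Tiling n m (k T)) → FixedBy T r2f τ ⇔ All (Palindrome (actBy r2f)) τ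
  fixedBy-r2f⇔ τ = mk⇔ lookup⁻ lookup⁺

  #fixedRows-map : ∀ g m → count (λ v → v ≟Row Vec.map (actBy g) v) (rows m) ≡ tfix T g ^ m
  #fixedRows-map g m = begin
    count (λ v → v ≟Row Vec.map σ v) (rows m)
      ≡⟨ ∑-cong (rows m) (λ v → 𝟙-cong (v ≟Row Vec.map σ v) (all? fixed? v) (fixed⇔All v)) ⟩
    count (all? fixed?) (rows m)
      ≡⟨ count-All designs fixed? m ⟩
    count fixed? designs ^ m
      ≡⟨ cong (_^ m) (tfix≡count g) ⟨
    tfix T g ^ m ∎
    where
    open ≡-Reasoning
    σ : Fin (k T) → Fin (k T)
    σ = actBy g
    fixed? : Decidable (λ d → d ≡ σ d)
    fixed? d = d Fin.≟ σ d
    fixed⇔All : ∀ v → (v ≡ Vec.map σ v) ⇔ All (λ d → d ≡ σ d) v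
    fixed⇔All v = mk⇔ lookup⁻ lookup⁺ ⇔-∘ ≡-map⇔ σ v v

  module FixedByF (f∈R : mem R f ≡ true) {m : ℕ} =
    RowPalindromes {m} (Vec.map (actBy f)) (map-involutive (actBy f) (actBy-involutive f∈R)) fixedBy-f⇔

  Fix-f-even : ∀ n m → mem R f ≡ true → n % 2 ≡ 0 → Fix T n m f ≡ tfix T e ^ ((n * m) / 2)
  Fix-f-even n m f∈R n%2≡0 with evenOdd n
  ... | odd q  = ⊥-elim (odd⇒%2≢0 q refl n%2≡0)
  ... | even q = trans (Fix-even q) (tfix-e^half (m * q) ([q*2]*m≡[m*q]*2 q m))
    where open FixedByF f∈R {m}

  Fix-f-odd : ∀ n m → mem R f ≡ true → n % 2 ≡ 1 →
              Fix T n m f ≡ tfix T e ^ ((m * (n ∸ 1)) / 2) * tfix T f ^ m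
  Fix-f-odd n m f∈R n%2≡1 with evenOdd n
  ... | even q = ⊥-elim (even⇒%2≢1 q refl n%2≡1)
  ... | odd q  = trans (Fix-odd q) (cong₂ _*_ (tfix-e^half (m * q) (sym (*-assoc m q 2))) (#fixedRows-map f m))
    where open FixedByF f∈R {m}

  Fix-r2f : ∀ n m (r2f∈R : mem R r2f ≡ true) → Fix T n m r2f ≡ DesignPalindromes.#palindromes r2f∈R m ^ n
  Fix-r2f n m r2f∈R = trans (Fix-cong {n} {m} (all? (palindrome? Fin._≟_ (actBy r2f))) fixedBy-r2f⇔)
                            (count-All (rows m) (palindrome? Fin._≟_ (actBy r2f)) n)

  Fix-r2f-even : ∀ n m → mem R r2f ≡ true → m % 2 ≡ 0 → Fix T n m r2f ≡ tfix T e ^ ((n * m) / 2)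
  Fix-r2f-even n m r2f∈R m%2≡0 with evenOdd m
  ... | odd b  = ⊥-elim (odd⇒%2≢0 b refl m%2≡0)
  ... | even b = begin
    Fix T n (b * 2) r2f                ≡⟨ Fix-r2f n _ r2f∈R ⟩
    #palindromes (b * 2) ^ n           ≡⟨ cong (_^ n) (#palindromes≡k^ b) ⟩
    (k T ^ b) ^ n                      ≡⟨ ^-*-assoc (k T) b n ⟩
    k T ^ (b * n)                      ≡⟨ tfix-e^half (b * n) (n*[b*2]≡[b*n]*2 n b) ⟩
    tfix T e ^ ((n * (b * 2)) / 2)     ∎
    where
    open ≡-Reasoning
    open DesignPalindromes r2f∈R

  Fix-r2f-odd : ∀ n m → mem R r2f ≡ true → m % 2 ≡ 1 →
                Fix T n m r2f ≡ tfix T e ^ ((n * (m ∸ 1)) / 2) * tfix T r2f ^ n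
  Fix-r2f-odd n m r2f∈R m%2≡1 with evenOdd m
  ... | even b = ⊥-elim (even⇒%2≢1 b refl m%2≡1)
  ... | odd b  = begin
    Fix T n (1 + b * 2) r2f
      ≡⟨ Fix-r2f n _ r2f∈R ⟩
    #palindromes (1 + b * 2) ^ n
      ≡⟨ cong (_^ n) (#palindromes≡k^*tfix b) ⟩
    (k T ^ b * tfix T r2f) ^ n
      ≡⟨ ^-distrib-* (k T ^ b) (tfix T r2f) n ⟩
    (k T ^ b) ^ n * tfix T r2f ^ n
      ≡⟨ cong (_* tfix T r2f ^ n) (^-*-assoc (k T) b n) ⟩
    k T ^ (b * n) * tfix T r2f ^ n
      ≡⟨ cong (_* tfix T r2f ^ n) (tfix-e^half (b * n) (n*[b*2]≡[b*n]*2 n b)) ⟩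
    tfix T e ^ ((n * (b * 2)) / 2) * tfix T r2f ^ n ∎
    where
    open ≡-Reasoning
    open DesignPalindromes r2f∈R

  module FixedByR2 (r2∈R : mem R r2 ≡ true) {m : ℕ} where
    open DesignPalindromes r2∈R public
    open RowPalindromes {m} (reverseMap (actBy r2)) (reverseMap-involutive (actBy r2) (actBy-involutive r2∈R))
                        fixedBy-r2⇔ public

    #fixedRows≡#palindromes : #fixedRows ≡ #palindromes m
    #fixedRows≡#palindromes =
      ∑-cong (rows m) (λ v → 𝟙-cong (v ≟Row reverseMap (actBy r2) v) (palindrome? Fin._≟_ (actBy r2) v)
                                    (≡-reverseMap⇔ (actBy r2) v v))

  Fix-r2-even : ∀ n m → mem R r2 ≡ true → (n * m) % 2 ≡ 0 → Fix T n m r2 ≡ tfix T e ^ ((n * m) / 2)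
  Fix-r2-even n m r2∈R nm%2≡0 with evenOdd n | evenOdd m
  ... | even q | _      = trans (Fix-even q) (tfix-e^half (m * q) ([q*2]*m≡[m*q]*2 q m))
    where open FixedByR2 r2∈R {m}
  ... | odd q  | odd b  =
    ⊥-elim (odd⇒%2≢0 ((1 + b * 2) * q + b) ([1+q*2]*[1+b*2]≡1+[[1+b*2]*q+b]*2 q b) nm%2≡0)
  ... | odd q  | even b = begin
    Fix T (1 + q * 2) (b * 2) r2
      ≡⟨ Fix-odd q ⟩
    k T ^ (b * 2 * q) * #fixedRows
      ≡⟨ cong (k T ^ (b * 2 * q) *_) #fixedRows≡k^ ⟩
    k T ^ (b * 2 * q) * k T ^ b
      ≡⟨ ^-distribˡ-+-* (k T) (b * 2 * q) b ⟨
    k T ^ (b * 2 * q + b)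
      ≡⟨ tfix-e^half (b * 2 * q + b) ([1+q*2]*[b*2]≡[b*2*q+b]*2 q b) ⟩
    tfix T e ^ (((1 + q * 2) * (b * 2)) / 2) ∎
    where
    open ≡-Reasoning
    open FixedByR2 r2∈R {b * 2}
    #fixedRows≡k^ : #fixedRows ≡ k T ^ b
    #fixedRows≡k^ = trans #fixedRows≡#palindromes (#palindromes≡k^ b)

  Fix-r2-odd : ∀ n m → mem R r2 ≡ true → (n * m) % 2 ≡ 1 →
               Fix T n m r2 ≡ tfix T e ^ ((n * m ∸ 1) / 2) * tfix T r2
  Fix-r2-odd n m r2∈R nm%2≡1 with evenOdd n | evenOdd m
  ... | even q | _      = ⊥-elim (even⇒%2≢1 (m * q) ([q*2]*m≡[m*q]*2 q m) nm%2≡1)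
  ... | odd q  | even b = ⊥-elim (even⇒%2≢1 (b * 2 * q + b) ([1+q*2]*[b*2]≡[b*2*q+b]*2 q b) nm%2≡1)
  ... | odd q  | odd b  = begin
    Fix T (1 + q * 2) m r2
      ≡⟨ Fix-odd q ⟩
    k T ^ (m * q) * #fixedRows
      ≡⟨ cong (k T ^ (m * q) *_) #fixedRows≡k^*tfix ⟩
    k T ^ (m * q) * (k T ^ b * tfix T r2)
      ≡⟨ *-assoc (k T ^ (m * q)) _ _ ⟨
    k T ^ (m * q) * k T ^ b * tfix T r2
      ≡⟨ cong (_* tfix T r2) (^-distribˡ-+-* (k T) (m * q) b) ⟨
    k T ^ (m * q + b) * tfix T r2
      ≡⟨ cong (_* tfix T r2) (tfix-e^half (m * q + b) exponent) ⟩
    tfix T e ^ (((1 + q * 2) * m ∸ 1) / 2) * tfix T r2 ∎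
    where
    open ≡-Reasoning
    open FixedByR2 r2∈R {m}
    #fixedRows≡k^*tfix : #fixedRows ≡ k T ^ b * tfix T r2
    #fixedRows≡k^*tfix = trans #fixedRows≡#palindromes (#palindromes≡k^*tfix b)
    exponent : (1 + q * 2) * m ∸ 1 ≡ (m * q + b) * 2
    exponent = cong (_∸ 1) ([1+q*2]*[1+b*2]≡1+[[1+b*2]*q+b]*2 q b)

  -- Orbits

  _≟Tiling_ : ∀ {n m} → DecidableEquality (Tiling n m (k T))
  _≟Tiling_ = Vecₚ.≡-dec _≟Row_

  mem? : ∀ g → Dec (mem R g ≡ true)
  mem? g = mem R g Bool.≟ true

  tiling-ext : ∀ {n m} {τ τ′ : Tiling n m (k T)} →
               (∀ x y → at τ (x , y) ≡ at τ′ (x , y)) → τ ≡ τ′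
  tiling-ext same = Pointwise-≡⇒≡ (ext (λ x → Pointwise-≡⇒≡ (ext (same x))))

  at-tilingAct : ∀ {n m} (τ : Tiling n m (k T)) g c → at (tilingAct T τ g) c ≡ act T (at τ (cellAct c g)) g
  at-tilingAct τ g (x , y) =
    trans (cong (λ row → lookup row y) (Vecₚ.lookup∘tabulate _ x)) (Vecₚ.lookup∘tabulate _ y)

  module Orbits (n m : ℕ) where

    private variable
      τ τ′ σ ρ : Tiling n m (k T)

    tilings : List (Tiling n m (k T))
    tilings = allTilings n m (k T)

    tilings-enumeration : IsEnumeration _≟Tiling_ tilings
    tilings-enumeration = allVecs-enumeration _≟Row_ rows-enumeration n

    ∈-tilings : ∀ τ → τ ∈ tilings
    ∈-tilings = ∈-enumeration _≟Tiling_ tilings tilings-enumeration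

    tilingAct-e : ∀ (τ : Tiling n m (k T)) → tilingAct T τ e ≡ τ
    tilingAct-e τ = tiling-ext (λ x y → trans (at-tilingAct τ e (x , y)) (act-e T _))

    tilingAct-· : ∀ (τ : Tiling n m (k T)) {g h} → mem R g ≡ true → mem R h ≡ true →
                  tilingAct T (tilingAct T τ g) h ≡ tilingAct T τ (g · h)
    tilingAct-· τ {g} {h} g∈R h∈R = tiling-ext (λ x y → begin
      at (tilingAct T (tilingAct T τ g) h) (x , y)
        ≡⟨ at-tilingAct (tilingAct T τ g) h (x , y) ⟩
      act T (at (tilingAct T τ g) (cellAct (x , y) h)) h
        ≡⟨ cong (λ d → act T d h) (at-tilingAct τ g _) ⟩
      act T (act T (at τ (cellAct (cellAct (x , y) h) g)) g) h
        ≡⟨ act-· T _ g h g∈R h∈R ⟩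
      act T (at τ (cellAct (cellAct (x , y) h) g)) (g · h)
        ≡⟨ cong (λ c → act T (at τ c) (g · h)) (cellAct-· (x , y) g h) ⟩
      act T (at τ (cellAct (x , y) (g · h))) (g · h)
        ≡⟨ at-tilingAct τ (g · h) (x , y) ⟨
      at (tilingAct T τ (g · h)) (x , y) ∎)
      where open ≡-Reasoning

    tilingAct-selfInverse : ∀ (τ : Tiling n m (k T)) {g} → mem R g ≡ true →
                            tilingAct T (tilingAct T τ g) g ≡ τ
    tilingAct-selfInverse τ {g} g∈R =
      trans (tilingAct-· τ g∈R g∈R) (trans (cong (tilingAct T τ) (·-selfInverse g)) (tilingAct-e τ))

    tilingAct-injective : ∀ {g} → mem R g ≡ true → tilingAct T τ g ≡ tilingAct T τ′ g → τ ≡ τ′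
    tilingAct-injective {τ} {τ′} {g} g∈R eq =
      trans (sym (tilingAct-selfInverse τ g∈R))
            (trans (cong (λ σ → tilingAct T σ g) eq) (tilingAct-selfInverse τ′ g∈R))

    fixedBy⇔ : ∀ (τ : Tiling n m (k T)) {g} → mem R g ≡ true → FixedBy T g τ ⇔ tilingAct T τ g ≡ τ
    fixedBy⇔ τ {g} g∈R = mk⇔
      (λ fixed → tiling-ext (λ x y → trans (at-tilingAct τ g (x , y))
                                          (trans (cong (λ d → act T d g) (fixed x y)) (actBy-involutive g∈R _))))
      (λ τg≡τ x y → let c = cellAct (x , y) g in
        trans (cong (λ σ → at σ c) (sym τg≡τ))
              (trans (at-tilingAct τ g c) (cong (λ c′ → act T (at τ c′) g) (cellAct-selfInverse (x , y) g))))

    sameOrbit-refl : ∀ (τ : Tiling n m (k T)) → SameOrbit T τ τ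
    sameOrbit-refl τ = e , has-e R , sym (tilingAct-e τ)

    sameOrbit-sym : SameOrbit T τ σ → SameOrbit T σ τ
    sameOrbit-sym {τ} (g , g∈R , refl) = g , g∈R , sym (tilingAct-selfInverse τ g∈R)

    sameOrbit-trans : SameOrbit T τ σ → SameOrbit T σ ρ → SameOrbit T τ ρ
    sameOrbit-trans {τ} (g , g∈R , refl) (h , h∈R , refl) =
      g · h , closed R g h g∈R h∈R , tilingAct-· τ g∈R h∈R

    sameOrbit? : ∀ (τ : Tiling n m (k T)) → Decidable (SameOrbit T τ)
    sameOrbit? τ σ = map′ satisfied (λ (g , p) → lose (∈-enumeration _≟D4_ allD4 allD4-enumeration g) p)
                                    (any? (λ g → mem? g ×-dec σ ≟Tiling tilingAct T τ g) allD4)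

    canonical : Tiling n m (k T) → Tiling n m (k T)
    canonical τ = fromMaybe τ (find (sameOrbit? τ) tilings)

    sameOrbit-canonical : ∀ (τ : Tiling n m (k T)) → SameOrbit T τ (canonical τ)
    sameOrbit-canonical τ = fromMaybe-find (sameOrbit? τ) tilings (sameOrbit-refl τ)

    canonical-cong : SameOrbit T τ σ → canonical τ ≡ canonical σ
    canonical-cong {τ} {σ} τ∼σ = begin
      fromMaybe τ (find (sameOrbit? τ) tilings)
        ≡⟨ fromMaybe-find-irrelevant (sameOrbit? τ) (∈-tilings τ) (sameOrbit-refl τ) ⟩
      fromMaybe σ (find (sameOrbit? τ) tilings)
        ≡⟨ cong (fromMaybe σ) (find-≐ (sameOrbit? τ) (sameOrbit? σ) τ≐σ tilings) ⟩
      fromMaybe σ (find (sameOrbit? σ) tilings) ∎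
      where
      open ≡-Reasoning
      τ≐σ : SameOrbit T τ ≐ SameOrbit T σ
      τ≐σ = (λ {ρ} → sameOrbit-trans {σ} {τ} {ρ} (sameOrbit-sym {τ} {σ} τ∼σ))
          , (λ {ρ} → sameOrbit-trans {τ} {σ} {ρ} τ∼σ)

    canonical-idempotent : ∀ (τ : Tiling n m (k T)) → canonical (canonical τ) ≡ canonical τ
    canonical-idempotent τ = canonical-cong (sameOrbit-sym {τ} (sameOrbit-canonical τ))

    canonical-tilingAct : ∀ (τ : Tiling n m (k T)) {g} → mem R g ≡ true →
                          canonical (tilingAct T τ g) ≡ canonical τ
    canonical-tilingAct τ g∈R = canonical-cong (sameOrbit-sym {τ} (_ , g∈R , refl))

    canonical? : Decidable (λ τ → canonical τ ≡ τ)
    canonical? τ = canonical τ ≟Tiling τ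

    representatives : List (Tiling n m (k T))
    representatives = filter canonical? tilings

    numOrbits : NumOrbits T n m (length representatives)
    numOrbits = List.lookup representatives , covers , separates
      where
      covers : ∀ τ → ∃ λ i → SameOrbit T (List.lookup representatives i) τ
      covers τ = Any.index rep∈ , subst (λ ρ → SameOrbit T ρ τ) (lookup-index rep∈)
                                        (sameOrbit-sym {τ} (sameOrbit-canonical τ))
        where
        rep∈ : canonical τ ∈ representatives
        rep∈ = ∈-filter⁺ canonical? (∈-tilings (canonical τ)) (canonical-idempotent τ)
      separates : ∀ i j → SameOrbit T (List.lookup representatives i) (List.lookup representatives j) → i ≡ j
      separates i j i∼j = lookup-injective representatives-unique i j (begin
        List.lookup representatives i
          ≡⟨ isCanonical i ⟨
        canonical (List.lookup representatives i)
          ≡⟨ canonical-cong {List.lookup representatives i} i∼j ⟩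
        canonical (List.lookup representatives j)
          ≡⟨ isCanonical j ⟩
        List.lookup representatives j ∎)
        where
        open ≡-Reasoning
        representatives-unique : Unique representatives
        representatives-unique =
          Unique.filter⁺ canonical? (enumeration-unique _≟Tiling_ tilings tilings-enumeration)
        isCanonical : ∀ i → canonical (List.lookup representatives i) ≡ List.lookup representatives i
        isCanonical i = All.lookup (all-filter canonical? tilings) (∈-lookup i)

    ∑-fixedBy : ∀ g → ∑[ τ ∈ tilings ] 𝟙 (mem? g ×-dec fixedBy? T g τ) ≡ 𝟙 (mem? g) * Fix T n m g
    ∑-fixedBy g = begin
      ∑[ τ ∈ tilings ] 𝟙 (mem? g ×-dec fixedBy? T g τ)
        ≡⟨ ∑-cong tilings (λ τ → 𝟙-×-dec (mem? g) (fixedBy? T g τ)) ⟩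
      ∑[ τ ∈ tilings ] 𝟙 (mem? g) * 𝟙 (fixedBy? T g τ)
        ≡⟨ ∑-*ˡ (𝟙 ∘ fixedBy? T g) (𝟙 (mem? g)) tilings ⟩
      𝟙 (mem? g) * count (fixedBy? T g) tilings
        ≡⟨ cong (𝟙 (mem? g) *_) (length-filter≡count (fixedBy? T g) tilings) ⟨
      𝟙 (mem? g) * Fix T n m g ∎
      where open ≡-Reasoning

    ∑-canonicalImage : ∀ g → ∑[ τ ∈ tilings ] 𝟙 (mem? g ×-dec canonical? (tilingAct T τ g)) ≡
                             𝟙 (mem? g) * length representatives
    ∑-canonicalImage g with mem? g
    ... | no  _   = ∑-zero tilings
    ... | yes g∈R = begin
      ∑[ τ ∈ tilings ] 𝟙 (canonical? (tilingAct T τ g))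
        ≡⟨ ∑-reindex _≟Tiling_ tilings tilings-enumeration (λ τ → tilingAct T τ g)
                     (λ τ → tilingAct-selfInverse τ g∈R) (𝟙 ∘ canonical?) ⟩
      count canonical? tilings
        ≡⟨ length-filter≡count canonical? tilings ⟨
      length representatives
        ≡⟨ *-identityˡ _ ⟨
      1 * length representatives ∎
      where open ≡-Reasoning

    stabiliser-reindex : ∀ τ → ∑[ g ∈ allD4 ] 𝟙 (mem? g ×-dec fixedBy? T g τ) ≡
                               ∑[ g ∈ allD4 ] 𝟙 (mem? g ×-dec canonical? (tilingAct T τ g))
    stabiliser-reindex τ with sameOrbit-canonical τ
    ... | g₀ , g₀∈R , canonical≡ =
      trans (∑-cong allD4 (λ g → 𝟙-cong (mem? g ×-dec fixedBy? T g τ)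
                                         (mem? (g · g₀) ×-dec canonical? (tilingAct T τ (g · g₀)))
                                         (mk⇔ (to g) (from g))))
            (∑-reindex _≟D4_ allD4 allD4-enumeration (_· g₀) (λ g → ·-cancelʳ g g₀)
                       (λ g → 𝟙 (mem? g ×-dec canonical? (tilingAct T τ g))))
      where
      canonical-image : ∀ {g} → mem R g ≡ true → canonical (tilingAct T τ g) ≡ tilingAct T τ g₀
      canonical-image g∈R = trans (canonical-tilingAct τ g∈R) canonical≡
      to : ∀ g → mem R g ≡ true × FixedBy T g τ →
           mem R (g · g₀) ≡ true × canonical (tilingAct T τ (g · g₀)) ≡ tilingAct T τ (g · g₀)
      to g (g∈R , fixed) = gg₀∈R , (begin
        canonical (tilingAct T τ (g · g₀))
          ≡⟨ canonical-image gg₀∈R ⟩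
        tilingAct T τ g₀
          ≡⟨ cong (λ σ → tilingAct T σ g₀) (Equivalence.to (fixedBy⇔ τ g∈R) fixed) ⟨
        tilingAct T (tilingAct T τ g) g₀
          ≡⟨ tilingAct-· τ g∈R g₀∈R ⟩
        tilingAct T τ (g · g₀) ∎)
        where
        open ≡-Reasoning
        gg₀∈R : mem R (g · g₀) ≡ true
        gg₀∈R = closed R g g₀ g∈R g₀∈R
      from : ∀ g → mem R (g · g₀) ≡ true × canonical (tilingAct T τ (g · g₀)) ≡ tilingAct T τ (g · g₀)
             → mem R g ≡ true × FixedBy T g τ
      from g (gg₀∈R , isCanonical) =
        g∈R , Equivalence.from (fixedBy⇔ τ g∈R) (tilingAct-injective g₀∈R (begin
        tilingAct T (tilingAct T τ g) g₀        ≡⟨ tilingAct-· τ g∈R g₀∈R ⟩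
        tilingAct T τ (g · g₀)                  ≡⟨ isCanonical ⟨
        canonical (tilingAct T τ (g · g₀))      ≡⟨ canonical-image gg₀∈R ⟩
        tilingAct T τ g₀                        ∎))
        where
        open ≡-Reasoning
        g∈R : mem R g ≡ true
        g∈R = subst (λ h → mem R h ≡ true) (·-cancelʳ g g₀) (closed R (g · g₀) g₀ gg₀∈R g₀∈R)

    burnside : order R * length representatives ≡ sumFix T n m
    burnside = begin
      order R * N
        ≡⟨ cong (_* N) (length-filter≡count mem? allD4) ⟩
      count mem? allD4 * N
        ≡⟨ ∑-*ʳ (𝟙 ∘ mem?) N allD4 ⟨
      ∑[ g ∈ allD4 ] 𝟙 (mem? g) * N
        ≡⟨ ∑-cong allD4 ∑-canonicalImage ⟨
      ∑[ g ∈ allD4 ] ∑[ τ ∈ tilings ] 𝟙 (mem? g ×-dec canonical? (tilingAct T τ g))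
        ≡⟨ ∑-comm allD4 tilings (λ g τ → 𝟙 (mem? g ×-dec canonical? (tilingAct T τ g))) ⟩
      ∑[ τ ∈ tilings ] ∑[ g ∈ allD4 ] 𝟙 (mem? g ×-dec canonical? (tilingAct T τ g))
        ≡⟨ ∑-cong tilings stabiliser-reindex ⟨
      ∑[ τ ∈ tilings ] ∑[ g ∈ allD4 ] 𝟙 (mem? g ×-dec fixedBy? T g τ)
        ≡⟨ ∑-comm tilings allD4 (λ τ g → 𝟙 (mem? g ×-dec fixedBy? T g τ)) ⟩
      ∑[ g ∈ allD4 ] ∑[ τ ∈ tilings ] 𝟙 (mem? g ×-dec fixedBy? T g τ)
        ≡⟨ ∑-cong allD4 ∑-fixedBy ⟩
      ∑[ g ∈ allD4 ] 𝟙 (mem? g) * Fix T n m g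
        ≡⟨ ∑-filter mem? (Fix T n m) allD4 ⟨
      sumFix T n m ∎
      where
      open ≡-Reasoning
      N : ℕ
      N = length representatives

mainTheorem2 : (n m : ℕ) → 1 ≤ n → 1 ≤ m → (R : Subgroup) → (T : TileDesigns R) →
      (mem R e ≡ true → Fix T n m e ≡ tfix T e ^ (n * m))
    × (mem R r2 ≡ true → (n * m) % 2 ≡ 0 → Fix T n m r2 ≡ tfix T e ^ ((n * m) / 2))
    × (mem R r2 ≡ true → (n * m) % 2 ≡ 1 →
         Fix T n m r2 ≡ tfix T e ^ ((n * m ∸ 1) / 2) * tfix T r2)
    × (mem R f ≡ true → n % 2 ≡ 0 → Fix T n m f ≡ tfix T e ^ ((n * m) / 2))
    × (mem R f ≡ true → n % 2 ≡ 1 →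
         Fix T n m f ≡ tfix T e ^ ((m * (n ∸ 1)) / 2) * tfix T f ^ m)
    × (mem R r2f ≡ true → m % 2 ≡ 0 → Fix T n m r2f ≡ tfix T e ^ ((n * m) / 2))
    × (mem R r2f ≡ true → m % 2 ≡ 1 →
         Fix T n m r2f ≡ tfix T e ^ ((n * (m ∸ 1)) / 2) * tfix T r2f ^ n)
    × Σ ℕ (λ N → NumOrbits T n m N × order R * N ≡ sumFix T n m)
mainTheorem2 n m _ _ R T =
    (λ _ → Fix-e T n m)
  , Fix-r2-even T n m
  , Fix-r2-odd T n m
  , Fix-f-even T n m
  , Fix-f-odd T n m
  , Fix-r2f-even T n m
  , Fix-r2f-odd T n m
  , length representatives , numOrbits , burnside
  where open Orbits T n m
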